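{- Let $\Gamma=(V,E)$ be a reduced graph and let $\pi_1\in\mathrm{Im}(\alpha)$. Then the subgraph of $\Gamma$ induced by any orbit of $\pi_1$ (i.e. of the cyclic group $\langle \pi_1\rangle$) on $V$ has no edges.
   Context: Graphs are finite, simple, loopless; $N(v)$ is the neighbourhood of $v$; reduced means $N(v)=N(w)\Rightarrow v=w$. $\mathrm{Aut}^{\pi}(\Gamma)$ is the group of bijections $\pi$ of $V$ such that every $\pi(N(v))$ equals $N(w)$ for some $w$; $\gamma(\pi)$ is the permutation with $N(\gamma(\pi)(v))=\pi(N(v))$. $\alpha:\mathrm{Aut}^{\pi}(\Gamma)\to\mathrm{Aut}^{\pi}(\Gamma)$ is $\alpha(\pi)=\pi^{ -1}\circ\gamma(\pi)$. -}

module Defs where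

open import Data.Nat using (ℕ; zero; suc)
open import Data.Fin using (Fin)
open import Data.Fin.Permutation using (Permutation′; _⟨$⟩ʳ_; _⟨$⟩ˡ_)
open import Data.Product using (Σ; ∃; _×_; _,_)
open import Relation.Binary.PropositionalEquality using (_≡_)
open import Relation.Nullary using (¬_)
open import Function using (_∘_)
open import Level using (0ℓ)

record Graph (n : ℕ) : Set₁ where
  field
    Adj   : Fin n → Fin n → Set
    sym   : ∀ {u v} → Adj u v → Adj v u
    irrefl : ∀ {v} → ¬ Adj v v
open Graph public

N : ∀ {n} → Graph n → Fin n → Fin n → Set
N Γ v u = Adj Γ v u

_≐_ : ∀ {n} → (Fin n → Set) → (Fin n → Set) → Set
A ≐ B = ∀ u → (A u → B u) × (B u → A u)

image : ∀ {n} → (Fin n → Fin n) → (Fin n → Set) → (Fin n → Set)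
image f A u = ∃ λ x → A x × f x ≡ u

Reduced : ∀ {n} → Graph n → Set
Reduced Γ = ∀ v w → N Γ v ≐ N Γ w → v ≡ w

InAutπ : ∀ {n} → Graph n → Permutation′ n → Set
InAutπ Γ π = ∀ v → ∃ λ w → image (π ⟨$⟩ʳ_) (N Γ v) ≐ N Γ w

-- g is γ(π): N(g v) = π(N v) for all v (unique for reduced Γ)
IsGamma : ∀ {n} → Graph n → Permutation′ n → Permutation′ n → Set
IsGamma Γ π g = ∀ v → N Γ (g ⟨$⟩ʳ v) ≐ image (π ⟨$⟩ʳ_) (N Γ v)

-- π₁ ∈ Im(α), α(π) = π⁻¹ ∘ γ(π)
InImα : ∀ {n} → Graph n → Permutation′ n → Set
InImα Γ π₁ = ∃ λ π → InAutπ Γ π × ∃ λ g → IsGamma Γ π g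
  × (∀ x → π₁ ⟨$⟩ʳ x ≡ π ⟨$⟩ˡ (g ⟨$⟩ʳ x))

iter : ∀ {n} → Permutation′ n → ℕ → Fin n → Fin n
iter π zero x = x
iter π (suc k) x = π ⟨$⟩ʳ iter π k x

-- u and v lie in the same orbit of ⟨π⟩ (finite: positive powers suffice)
SameOrbit : ∀ {n} → Permutation′ n → Fin n → Fin n → Set
SameOrbit π u v = ∃ λ k → iter π k u ≡ v

-- Write γ for γ(π) and σ = π⁻¹ ∘ γ for the given element of Im(α).  The defining
-- property of γ says that v ~ x iff γ v ~ π x, and since π ∘ σ = γ this yields
-- (i) a ≁ σ a, as otherwise γ a ~ γ a, and (ii) a ~ σ b implies σ a ~ b, through
-- γ a ~ γ b.  By (ii), an edge a ~ σ^(k+2) a moves to the edge σ a ~ σ^k (σ a),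
-- so every edge inside an orbit descends to one excluded by irreflexivity or by (i).
module Submission where

open import Defs
open import Data.Nat using (zero; suc)
open import Data.Fin using (Fin)
open import Data.Fin.Permutation using (Permutation′; _⟨$⟩ʳ_; _⟨$⟩ˡ_; inverseˡ; inverseʳ)
open import Data.Product using (_,_; proj₁; proj₂)
open import Relation.Nullary using (¬_)
open import Relation.Binary.PropositionalEquality
  using (_≡_; refl; cong; subst; module ≡-Reasoning)
  renaming (sym to ≡-sym; trans to ≡-trans)

iter-suc : ∀ {n} (σ : Permutation′ n) k a → iter σ (suc k) a ≡ iter σ k (σ ⟨$⟩ʳ a)
iter-suc σ zero    a = refl
iter-suc σ (suc k) a = cong (σ ⟨$⟩ʳ_) (iter-suc σ k a)

⟨$⟩ʳ-injective : ∀ {n} (π : Permutation′ n) {x y} → π ⟨$⟩ʳ x ≡ π ⟨$⟩ʳ y → x ≡ y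
⟨$⟩ʳ-injective π {x} {y} eq = begin
  x                   ≡⟨ ≡-sym (inverseˡ π) ⟩
  π ⟨$⟩ˡ (π ⟨$⟩ʳ x)   ≡⟨ cong (π ⟨$⟩ˡ_) eq ⟩
  π ⟨$⟩ˡ (π ⟨$⟩ʳ y)   ≡⟨ inverseˡ π ⟩
  y                   ∎
  where open ≡-Reasoning

module _ {n} (Γ : Graph n) where

  SelfAdjoint : Permutation′ n → Set
  SelfAdjoint σ = ∀ {a b} → Adj Γ a (σ ⟨$⟩ʳ b) → Adj Γ (σ ⟨$⟩ʳ a) b

  MovesToNonNeighbours : Permutation′ n → Set
  MovesToNonNeighbours σ = ∀ a → ¬ Adj Γ a (σ ⟨$⟩ʳ a)

  orbit-independent : ∀ {σ} → SelfAdjoint σ → MovesToNonNeighbours σ →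
                      ∀ k a → ¬ Adj Γ a (iter σ k a)
  orbit-independent σ-adj σ-mov zero          a a~a  = irrefl Γ a~a
  orbit-independent σ-adj σ-mov (suc zero)    a a~σa = σ-mov a a~σa
  orbit-independent {σ} σ-adj σ-mov (suc (suc k)) a a~σ²⁺ᵏa =
    orbit-independent σ-adj σ-mov k (σ ⟨$⟩ʳ a)
      (σ-adj (subst (λ z → Adj Γ a (σ ⟨$⟩ʳ z)) (iter-suc σ k a) a~σ²⁺ᵏa))

  module _ {π g : Permutation′ n} (g-isγ : IsGamma Γ π g) where

    Adj⇒Adj-γ : ∀ {v x} → Adj Γ v x → Adj Γ (g ⟨$⟩ʳ v) (π ⟨$⟩ʳ x)
    Adj⇒Adj-γ {v} {x} v~x = proj₂ (g-isγ v (π ⟨$⟩ʳ x)) (x , v~x , refl)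

    Adj-γ⇒Adj : ∀ {v x} → Adj Γ (g ⟨$⟩ʳ v) (π ⟨$⟩ʳ x) → Adj Γ v x
    Adj-γ⇒Adj {v} {x} gv~πx with proj₁ (g-isγ v (π ⟨$⟩ʳ x)) gv~πx
    ... | x′ , v~x′ , πx′≡πx = subst (Adj Γ v) (⟨$⟩ʳ-injective π πx′≡πx) v~x′

    module _ (σ : Permutation′ n) (πσ≡g : ∀ x → π ⟨$⟩ʳ (σ ⟨$⟩ʳ x) ≡ g ⟨$⟩ʳ x) where

      Adj⇒Adj-γγ : ∀ {a b} → Adj Γ a (σ ⟨$⟩ʳ b) → Adj Γ (g ⟨$⟩ʳ a) (g ⟨$⟩ʳ b)
      Adj⇒Adj-γγ {a} {b} a~σb = subst (Adj Γ (g ⟨$⟩ʳ a)) (πσ≡g b) (Adj⇒Adj-γ a~σb)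

      Adj-γγ⇒Adj : ∀ {a b} → Adj Γ (g ⟨$⟩ʳ a) (g ⟨$⟩ʳ b) → Adj Γ a (σ ⟨$⟩ʳ b)
      Adj-γγ⇒Adj {a} {b} ga~gb = Adj-γ⇒Adj (subst (Adj Γ (g ⟨$⟩ʳ a)) (≡-sym (πσ≡g b)) ga~gb)

      selfAdjoint : SelfAdjoint σ
      selfAdjoint a~σb = sym Γ (Adj-γγ⇒Adj (sym Γ (Adj⇒Adj-γγ a~σb)))

      movesToNonNeighbours : MovesToNonNeighbours σ
      movesToNonNeighbours a a~σa = irrefl Γ (Adj⇒Adj-γγ a~σa)

corollary2p7 : ∀ {n} (Γ : Graph n) → Reduced Γ → (π₁ : Permutation′ n) → InImα Γ π₁ →
    ∀ (u v : Fin n) → SameOrbit π₁ u v → ¬ Adj Γ u v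
corollary2p7 Γ _ σ (π , _ , g , g-isγ , σ≡π⁻¹g) u v (k , refl) =
  orbit-independent Γ (selfAdjoint Γ {π} {g} g-isγ σ πσ≡g)
                      (movesToNonNeighbours Γ {π} {g} g-isγ σ πσ≡g) k u
  where
  πσ≡g : ∀ x → π ⟨$⟩ʳ (σ ⟨$⟩ʳ x) ≡ g ⟨$⟩ʳ x
  πσ≡g x = ≡-trans (cong (π ⟨$⟩ʳ_) (σ≡π⁻¹g x)) (inverseʳ π)
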